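{- Let $n\in\mathbb N$ and $1\le j\le n$. In the Jaco graph $J_n(1)$, the shortest path from $v_1$ to $v_j$ is unique if and only if $d^+(v_j)\in\mathbb F$.
   Context: $J_\infty(1)$ is the directed graph with vertex set $\{v_i:i\in\mathbb N\}$ in which every arc has the form $(v_i,v_j)$ with $i<j$, and for $i<j$, $(v_i,v_j)$ is an arc iff $2i-d^-(v_i)\ge j$, where $d^-(v_i)$ is the in-degree of $v_i$ (determined recursively). $J_n(1)$ is the subgraph of $J_\infty(1)$ induced on $\{v_1,\dots,v_n\}$. Paths are directed paths; the shortest path from $v_1$ to $v_1$ is the trivial path. Here $d^+(v_j)$ denotes the out-degree of $v_j$ in $J_\infty(1)$. $\mathbb F=\{f_0,f_1,f_2,\dots\}$ is the set of Fibonacci numbers, $f_0=0$, $f_1=1$, $f_{m+1}=f_m+f_{m-1}$. -}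

module Defs where

open import Data.Nat using (ℕ; zero; suc; _+_; _*_; _∸_; _≤_; _<_; _≤?_; _<?_; _≟_)
open import Data.List using (List; []; _∷_; length; filter; map; upTo)
open import Data.Product using (Σ; _×_; ∃)
open import Relation.Nullary using (Dec; yes; no)
open import Relation.Nullary.Decidable using (_×-dec_)
open import Relation.Binary.PropositionalEquality using (_≡_)

-- Vertices v_i of J_∞(1) are represented by their index i ∈ {1,2,3,...}.

range1 : ℕ → List ℕ
range1 n = map suc (upTo n)

-- inTable n i = d⁻(v_i) for 1 ≤ i ≤ n (computed stage by stage; 0 elsewhere).
-- Stage suc n: d⁻(v_{n+1}) = #{ k ∈ [1,n] : 2k - d⁻(v_k) ≥ n+1 }.
inTable : ℕ → ℕ → ℕ
inTable zero    i = 0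
inTable (suc n) i with i ≟ suc n
... | yes _ = length (filter (λ k → suc n ≤? 2 * k ∸ inTable n k) (range1 n))
... | no  _ = inTable n i

indeg : ℕ → ℕ
indeg i = inTable i i

Arc : ℕ → ℕ → Set
Arc i j = 1 ≤ i × i < j × j ≤ 2 * i ∸ indeg i

Arc? : (i j : ℕ) → Dec (Arc i j)
Arc? i j = (1 ≤? i) ×-dec ((i <? j) ×-dec (j ≤? 2 * i ∸ indeg i))

-- out-degree d⁺(v_i) in J_∞(1): number of j with (v_i,v_j) an arc
-- (every such j satisfies j ≤ 2i, so counting over [1,2i] is exhaustive)
outdeg : ℕ → ℕ
outdeg i = length (filter (Arc? i) (range1 (2 * i)))

fib : ℕ → ℕ
fib zero          = 0
fib (suc zero)    = 1
fib (suc (suc m)) = fib (suc m) + fib m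

-- Directed paths in J_n(1) from v_1, represented as the list of vertex
-- indices in REVERSE order (last vertex first).  Its length is length p - 1.
data PathJ (n : ℕ) : ℕ → List ℕ → Set where
  trivial : 1 ≤ n → PathJ n 1 (1 ∷ [])
  extend  : ∀ {i k xs} → PathJ n i (i ∷ xs) → Arc i k → k ≤ n →
            PathJ n k (k ∷ i ∷ xs)

UniqueShortestPath : ℕ → ℕ → Set
UniqueShortestPath n j =
  Σ (List ℕ) λ p → PathJ n j p
    × (∀ q → PathJ n j q → length p ≤ length q)
    × (∀ q → PathJ n j q → length q ≡ length p → q ≡ p)

module Submission where

-- Let reach k = 2k − d⁻(v_k), the largest out-neighbour of v_k.  By a joint induction on k, reach is
-- strictly increasing and reach k = k + c, where c = d⁺(v_k) is the least vertex with k ≤ reach c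
-- (counting the in-neighbours of v_{k+1} needs the monotonicity up to k).  In particular
-- reach f_{e+2} = f_{e+3}, so a path with m vertices ends at most at v_{f_{m+1}}, and for
-- f_{e+2} < j ≤ f_{e+3} the shortest paths to v_j have e + 2 vertices, while d⁺(v_j) lies in
-- (f_{e+1}, f_{e+2}] (is 1 when e = 0) and so is a Fibonacci number iff it equals f_{e+2}.
-- If d⁺(v_j) = f_{e+2}, the penultimate vertex of a shortest path is forced to be v_{f_{e+2}}, whose
-- out-degree is f_{e+1}, and so on down to v_1.  If d⁺(v_j) < f_{e+2}, both v_{d⁺(v_j)} and
-- v_{d⁺(v_j)+1} reach v_j and start shortest paths.

open import Defs
open import Data.Nat using (ℕ; _≤_)
open import Data.Product using (∃)
open import Function.Bundles using (_⇔_)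
open import Relation.Binary.PropositionalEquality using (_≡_)

open import Data.Nat
open import Data.Nat.Properties
open import Data.List using ([]; _∷_; [_]; length; filter; map; upTo; _++_)
open import Data.List.Properties using (∷-injectiveˡ; ∷-injectiveʳ; map-++; applyUpTo-∷ʳ; length-++; filter-++; filter-accept; filter-reject)
open import Data.Product using (_×_; _,_; proj₁; proj₂)
open import Data.Sum using (inj₁; inj₂)
open import Relation.Binary.Definitions using (tri<; tri≈; tri>)
open import Function using (_∘_; id)
open import Function.Bundles using (mk⇔)
open import Level using (0ℓ)
open import Relation.Nullary using (¬_; Dec; yes; no; contradiction)
open import Relation.Unary using (Pred; Decidable)
open import Relation.Binary.PropositionalEquality using (_≢_; refl; sym; trans; cong; subst; subst₂; module ≡-Reasoning)

range1-suc : ∀ N → range1 (suc N) ≡ range1 N ++ [ suc N ]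
range1-suc N = trans (cong (map suc) (sym (applyUpTo-∷ʳ id N))) (map-++ suc (upTo N) [ N ])

module Counting {P : Pred ℕ 0ℓ} (P? : Decidable P) where

  count : ℕ → ℕ
  count N = length (filter P? (range1 N))

  count-suc : ∀ N → count (suc N) ≡ count N + length (filter P? [ suc N ])
  count-suc N = begin
    length (filter P? (range1 (suc N)))                 ≡⟨ cong (length ∘ filter P?) (range1-suc N) ⟩
    length (filter P? (range1 N ++ [ suc N ]))          ≡⟨ cong length (filter-++ P? (range1 N) _) ⟩
    length (filter P? (range1 N) ++ filter P? [ suc N ]) ≡⟨ length-++ (filter P? (range1 N)) ⟩
    count N + length (filter P? [ suc N ])               ∎
    where open ≡-Reasoning

  count-accept : ∀ {N} → P (suc N) → count (suc N) ≡ suc (count N)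
  count-accept {N} p = begin
    count (suc N)                          ≡⟨ count-suc N ⟩
    count N + length (filter P? [ suc N ]) ≡⟨ cong (λ xs → count N + length xs) (filter-accept P? p) ⟩
    count N + 1                            ≡⟨ +-comm (count N) 1 ⟩
    suc (count N)                          ∎
    where open ≡-Reasoning

  count-reject : ∀ {N} → ¬ P (suc N) → count (suc N) ≡ count N
  count-reject {N} ¬p = begin
    count (suc N)                          ≡⟨ count-suc N ⟩
    count N + length (filter P? [ suc N ]) ≡⟨ cong (λ xs → count N + length xs) (filter-reject P? ¬p) ⟩
    count N + 0                            ≡⟨ +-identityʳ (count N) ⟩
    count N                                ∎
    where open ≡-Reasoning

  count-interval : ∀ a b N → b ≤ N →
    (∀ {k} → 1 ≤ k → k ≤ N → P k → a < k × k ≤ b) →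
    (∀ {k} → 1 ≤ k → a < k → k ≤ b → P k) →
    count N ≡ b ∸ a
  count-interval a .0 zero z≤n _ _ = sym (0∸n≡0 a)
  count-interval a b (suc N) b≤1+N into onto with m≤n⇒m<n∨m≡n b≤1+N
  ... | inj₁ b≤N = trans (count-reject (λ p → <⇒≱ b≤N (proj₂ (into z<s ≤-refl p))))
                         (count-interval a b N (s≤s⁻¹ b≤N) (λ 1≤k k≤N → into 1≤k (m≤n⇒m≤1+n k≤N)) onto)
  ... | inj₂ refl = through-top (a <? suc N)
    where
      open ≡-Reasoning
      below-top : count N ≡ N ∸ a
      below-top = count-interval a N N ≤-refl
        (λ 1≤k k≤N p → proj₁ (into 1≤k (m≤n⇒m≤1+n k≤N) p) , k≤N)
        (λ 1≤k a<k k≤N → onto 1≤k a<k (m≤n⇒m≤1+n k≤N))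
      through-top : Dec (a < suc N) → count (suc N) ≡ suc N ∸ a
      through-top (yes a<1+N) = begin
        count (suc N)  ≡⟨ count-accept (onto z<s a<1+N ≤-refl) ⟩
        suc (count N)  ≡⟨ cong suc below-top ⟩
        suc (N ∸ a)    ≡⟨ +-∸-assoc 1 (s≤s⁻¹ a<1+N) ⟨
        suc N ∸ a      ∎
      through-top (no a≮1+N) = begin
        count (suc N) ≡⟨ count-reject (λ p → a≮1+N (proj₁ (into z<s ≤-refl p))) ⟩
        count N       ≡⟨ below-top ⟩
        N ∸ a         ≡⟨ m≤n⇒m∸n≡0 (≤-trans (n≤1+n N) (≮⇒≥ a≮1+N)) ⟩
        0             ≡⟨ m≤n⇒m∸n≡0 (≮⇒≥ a≮1+N) ⟨
        suc N ∸ a     ∎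

inTable-other : ∀ N {i} → i ≢ suc N → inTable (suc N) i ≡ inTable N i
inTable-other N {i} i≢1+N with i ≟ suc N
... | yes i≡1+N = contradiction i≡1+N i≢1+N
... | no _      = refl

inTable-stable : ∀ {N i} → i ≤ N → inTable N i ≡ indeg i
inTable-stable {zero}  z≤n = refl
inTable-stable {suc N} i≤1+N with m≤n⇒m<n∨m≡n i≤1+N
... | inj₂ refl = refl
... | inj₁ i<1+N = trans (inTable-other N (λ i≡ → <-irrefl i≡ i<1+N)) (inTable-stable (s≤s⁻¹ i<1+N))

indeg-suc : ∀ N → indeg (suc N) ≡ length (filter (λ k → suc N ≤? 2 * k ∸ inTable N k) (range1 N))
indeg-suc N with suc N ≟ suc N
... | yes _  = refl
... | no ¬refl = contradiction refl ¬refl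

reach : ℕ → ℕ
reach k = 2 * k ∸ indeg k

reach≤double : ∀ k → reach k ≤ k + k
reach≤double k = subst (reach k ≤_) (cong (k +_) (+-identityʳ k)) (m∸n≤m (2 * k) (indeg k))

2*k∸[k∸m]≡k+m : ∀ {k m} → m ≤ k → 2 * k ∸ (k ∸ m) ≡ k + m
2*k∸[k∸m]≡k+m {k} {m} m≤k = begin
  2 * k ∸ (k ∸ m)     ≡⟨ cong (λ x → k + x ∸ (k ∸ m)) (+-identityʳ k) ⟩
  k + k ∸ (k ∸ m)     ≡⟨ +-∸-assoc k (m∸n≤m k m) ⟩
  k + (k ∸ (k ∸ m))   ≡⟨ cong (k +_) (m∸[m∸n]≡n m≤k) ⟩
  k + m               ∎
  where open ≡-Reasoning

record LeastReaching (k c : ℕ) : Set where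
  constructor leastReaching
  field
    positive : 1 ≤ c
    reaches  : k ≤ reach c
    least    : ∀ {i} → 1 ≤ i → i < c → reach i < k

Anchor : ℕ → ℕ → Set
Anchor k c = reach k ≡ k + c × LeastReaching k c

anchor-≤ : ∀ {k c} → reach k ≡ k + c → c ≤ k
anchor-≤ {k} {c} reach≡ = +-cancelˡ-≤ k c k (subst (_≤ k + k) reach≡ (reach≤double k))

ReachIncreasingUpTo : ℕ → Set
ReachIncreasingUpTo N = ∀ {a} → 1 ≤ a → suc a ≤ N → reach a < reach (suc a)

module _ {N} (increasing : ReachIncreasingUpTo N) where

  reach-mono-<-upTo : ∀ {a b} → 1 ≤ a → a < b → b ≤ N → reach a < reach b
  reach-mono-<-upTo {a} {suc b} 1≤a a<1+b 1+b≤N with m≤n⇒m<n∨m≡n (s≤s⁻¹ a<1+b)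
  ... | inj₂ refl = increasing 1≤a 1+b≤N
  ... | inj₁ a<b  = <-trans (reach-mono-<-upTo 1≤a a<b (≤-trans (n≤1+n b) 1+b≤N))
                            (increasing (≤-trans 1≤a (<⇒≤ a<b)) 1+b≤N)

  reach-mono-≤-upTo : ∀ {a b} → 1 ≤ a → a ≤ b → b ≤ N → reach a ≤ reach b
  reach-mono-≤-upTo 1≤a a≤b b≤N with m≤n⇒m<n∨m≡n a≤b
  ... | inj₂ refl = ≤-refl
  ... | inj₁ a<b  = <⇒≤ (reach-mono-<-upTo 1≤a a<b b≤N)

  leastReaching-next : ∀ {c} → 1 ≤ N → Anchor N c → ∃ λ m → LeastReaching (suc N) m × c ≤ m × m ≤ N
  leastReaching-next {c} 1≤N (reachN≡ , leastReaching 1≤c N≤reach-c least) with suc N ≤? reach c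
  ... | yes 1+N≤reach-c =
    c , leastReaching 1≤c 1+N≤reach-c (λ 1≤i i<c → m<n⇒m<1+n (least 1≤i i<c)) , ≤-refl , anchor-≤ reachN≡
  ... | no 1+N≰reach-c = suc c , leastReaching z<s 1+N≤reach-1+c least′ , n≤1+n c , c<N
    where
      reach-c≡N : reach c ≡ N
      reach-c≡N = ≤-antisym (s≤s⁻¹ (≰⇒> 1+N≰reach-c)) N≤reach-c
      c<N : c < N
      c<N = ≤∧≢⇒< (anchor-≤ reachN≡) λ { refl → <-irrefl (trans (sym reach-c≡N) reachN≡) (m<m+n N 1≤c) }
      1+N≤reach-1+c : suc N ≤ reach (suc c)
      1+N≤reach-1+c = subst (_< reach (suc c)) reach-c≡N (increasing 1≤c c<N)
      least′ : ∀ {i} → 1 ≤ i → i < suc c → reach i < suc N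
      least′ 1≤i i<1+c with m≤n⇒m<n∨m≡n (s≤s⁻¹ i<1+c)
      ... | inj₁ i<c  = m<n⇒m<1+n (least 1≤i i<c)
      ... | inj₂ refl = ≰⇒> 1+N≰reach-c

  indeg-from-leastReaching : ∀ {m} → LeastReaching (suc N) m → m ≤ N → indeg (suc N) ≡ suc N ∸ m
  indeg-from-leastReaching {zero} (leastReaching () _ _) _
  indeg-from-leastReaching {suc a} (leastReaching _ 1+N≤reach-m least) m≤N =
    trans (indeg-suc N) (count-interval a N N ≤-refl into onto)
    where
      open Counting (λ k → suc N ≤? 2 * k ∸ inTable N k)
      into : ∀ {k} → 1 ≤ k → k ≤ N → suc N ≤ 2 * k ∸ inTable N k → a < k × k ≤ N
      into {k} 1≤k k≤N reaches with a <? k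
      ... | yes a<k = a<k , k≤N
      ... | no a≮k = contradiction (subst (λ d → suc N ≤ 2 * k ∸ d) (inTable-stable k≤N) reaches)
                                   (<⇒≱ (least 1≤k (s≤s (≮⇒≥ a≮k))))
      onto : ∀ {k} → 1 ≤ k → a < k → k ≤ N → suc N ≤ 2 * k ∸ inTable N k
      onto {k} _ a<k k≤N = subst (λ d → suc N ≤ 2 * k ∸ d) (sym (inTable-stable k≤N))
                             (≤-trans 1+N≤reach-m (reach-mono-≤-upTo z<s a<k k≤N))

  anchor-next : ∀ {c} → 1 ≤ N → Anchor N c → ∃ (Anchor (suc N)) × reach N < reach (suc N)
  anchor-next {c} 1≤N anchorN@(reachN≡ , _) with leastReaching-next 1≤N anchorN
  ... | m , leastM , c≤m , m≤N = (m , reach-1+N≡ , leastM) , reachN<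
    where
      reach-1+N≡ : reach (suc N) ≡ suc N + m
      reach-1+N≡ = trans (cong (2 * suc N ∸_) (indeg-from-leastReaching leastM m≤N))
                         (2*k∸[k∸m]≡k+m (m≤n⇒m≤1+n m≤N))
      reachN< : reach N < reach (suc N)
      reachN< = subst₂ _<_ (sym reachN≡) (sym reach-1+N≡) (s≤s (+-monoʳ-≤ N c≤m))

Invariant : ℕ → Set
Invariant N = (∀ {k} → 1 ≤ k → k ≤ N → ∃ (Anchor k)) × ReachIncreasingUpTo N

invariant : ∀ N → Invariant N
invariant zero          = (λ { (s≤s _) () }) , λ { _ () }
invariant (suc zero)    = (λ { (s≤s z≤n) (s≤s z≤n) → 1 , refl , leastReaching ≤-refl (s≤s z≤n) λ { (s≤s _) (s≤s ()) } })
                        , λ { (s≤s _) (s≤s ()) }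
invariant (suc (suc N)) with invariant (suc N)
... | anchors , increasing with anchor-next increasing z<s (proj₂ (anchors z<s ≤-refl))
...   | anchorNext , step = anchors′ , increasing′
  where
    anchors′ : ∀ {k} → 1 ≤ k → k ≤ suc (suc N) → ∃ (Anchor k)
    anchors′ 1≤k k≤ with m≤n⇒m<n∨m≡n k≤
    ... | inj₂ refl = anchorNext
    ... | inj₁ k<   = anchors 1≤k (s≤s⁻¹ k<)
    increasing′ : ReachIncreasingUpTo (suc (suc N))
    increasing′ 1≤a a< with m≤n⇒m<n∨m≡n a<
    ... | inj₂ refl = step
    ... | inj₁ a<′  = increasing 1≤a (s≤s⁻¹ a<′)

anchor-exists : ∀ {k} → 1 ≤ k → ∃ (Anchor k)
anchor-exists {k} 1≤k = proj₁ (invariant k) 1≤k ≤-refl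

reach-mono-< : ∀ {a b} → 1 ≤ a → a < b → reach a < reach b
reach-mono-< {b = b} 1≤a a<b = reach-mono-<-upTo (proj₂ (invariant b)) 1≤a a<b ≤-refl

reach-mono-≤ : ∀ {a b} → 1 ≤ a → a ≤ b → reach a ≤ reach b
reach-mono-≤ {b = b} 1≤a a≤b = reach-mono-≤-upTo (proj₂ (invariant b)) 1≤a a≤b ≤-refl

outdeg≡reach∸self : ∀ {j} → 1 ≤ j → outdeg j ≡ reach j ∸ j
outdeg≡reach∸self {j} 1≤j = count-interval j (reach j) (2 * j) (m∸n≤m (2 * j) (indeg j))
  (λ _ _ (_ , j<k , k≤reach) → j<k , k≤reach) (λ _ j<k k≤reach → 1≤j , j<k , k≤reach)
  where open Counting (Arc? j)

anchor-outdeg : ∀ {k} → 1 ≤ k → Anchor k (outdeg k)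
anchor-outdeg {k} 1≤k with anchor-exists 1≤k
... | c , reach≡ , leastC = subst (Anchor k) (sym outdeg≡c) (reach≡ , leastC)
  where
    outdeg≡c : outdeg k ≡ c
    outdeg≡c = trans (outdeg≡reach∸self 1≤k) (trans (cong (_∸ k) reach≡) (m+n∸m≡n k c))

module _ {k} (1≤k : 1 ≤ k) where

  reach≡+outdeg : reach k ≡ k + outdeg k
  reach≡+outdeg = proj₁ (anchor-outdeg 1≤k)

  outdeg-positive : 1 ≤ outdeg k
  outdeg-positive = LeastReaching.positive (proj₂ (anchor-outdeg 1≤k))

  reach-outdeg : k ≤ reach (outdeg k)
  reach-outdeg = LeastReaching.reaches (proj₂ (anchor-outdeg 1≤k))

  outdeg-minimal : ∀ {i} → 1 ≤ i → k ≤ reach i → outdeg k ≤ i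
  outdeg-minimal {i} 1≤i k≤reach-i =
    ≮⇒≥ λ i<outdeg → <⇒≱ (LeastReaching.least (proj₂ (anchor-outdeg 1≤k)) 1≤i i<outdeg) k≤reach-i

  <-outdeg : ∀ {b} → 1 ≤ b → reach b < k → b < outdeg k
  <-outdeg 1≤b reach-b<k = ≰⇒> λ outdeg≤b → <⇒≱ reach-b<k (≤-trans reach-outdeg (reach-mono-≤ outdeg-positive outdeg≤b))

<-reach : ∀ {k} → 1 ≤ k → k < reach k
<-reach {k} 1≤k = subst (k <_) (sym (reach≡+outdeg 1≤k)) (m<m+n k (outdeg-positive 1≤k))

outdeg-reach : ∀ {b} → 1 ≤ b → outdeg (reach b) ≡ b
outdeg-reach {b} 1≤b = ≤-antisym (outdeg-minimal 1≤reach 1≤b ≤-refl)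
  (≮⇒≥ λ outdeg<b → <⇒≱ (reach-mono-< (outdeg-positive 1≤reach) outdeg<b) (reach-outdeg 1≤reach))
  where
    1≤reach : 1 ≤ reach b
    1≤reach = ≤-trans 1≤b (<⇒≤ (<-reach 1≤b))

fib-positive : ∀ n → 1 ≤ fib (suc n)
fib-positive zero    = ≤-refl
fib-positive (suc n) = ≤-trans (fib-positive n) (m≤m+n (fib (suc n)) (fib n))

fib-≤-suc : ∀ n → fib n ≤ fib (suc n)
fib-≤-suc zero    = z≤n
fib-≤-suc (suc n) = m≤m+n (fib (suc n)) (fib n)

fib-mono : ∀ {a b} → a ≤ b → fib a ≤ fib b
fib-mono {a} {b} a≤b with m≤n⇒m<n∨m≡n a≤b
... | inj₂ refl = ≤-refl
fib-mono {a} {suc b} _ | inj₁ a<1+b = ≤-trans (fib-mono (s≤s⁻¹ a<1+b)) (fib-≤-suc b)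

fib-<-suc : ∀ n → fib (2 + n) < fib (3 + n)
fib-<-suc n = subst (_≤ fib (2 + n) + fib (suc n)) (+-comm (fib (2 + n)) 1) (+-monoʳ-≤ (fib (2 + n)) (fib-positive n))

fib-window : ∀ j → 2 ≤ j → ∃ λ e → fib (2 + e) < j × j ≤ fib (3 + e)
fib-window (suc zero) (s≤s ())
fib-window (suc (suc zero))    _ = 0 , s≤s (s≤s z≤n) , ≤-refl
fib-window (suc (suc (suc j))) _ with fib-window (suc (suc j)) (s≤s (s≤s z≤n))
... | e , lo , hi with m≤n⇒m<n∨m≡n hi
...   | inj₁ j<  = e , m<n⇒m<1+n lo , j<
...   | inj₂ j≡  = suc e , subst (_< 3 + j) j≡ ≤-refl , subst (λ x → suc x ≤ fib (4 + e)) (sym j≡) (fib-<-suc (suc e))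

fib-in-window : ∀ e m → fib (2 + e) < fib m → fib m ≤ fib (3 + e) → fib m ≡ fib (3 + e)
fib-in-window e m lo hi with <-cmp m (3 + e)
... | tri≈ _ refl _ = refl
... | tri< m<      _ _ = contradiction (fib-mono (s≤s⁻¹ m<)) (<⇒≱ lo)
... | tri> _ _ m>      = contradiction hi (<⇒≱ (<-≤-trans (fib-<-suc (suc e)) (fib-mono m>)))

reach-fib : ∀ e → reach (fib (2 + e)) ≡ fib (3 + e)
reach-fib zero    = refl
reach-fib (suc e) = begin
  reach (fib (3 + e))                      ≡⟨ reach≡+outdeg (fib-positive (2 + e)) ⟩
  fib (3 + e) + outdeg (fib (3 + e))       ≡⟨ cong (λ x → fib (3 + e) + outdeg x) (reach-fib e) ⟨
  fib (3 + e) + outdeg (reach (fib (2 + e))) ≡⟨ cong (fib (3 + e) +_) (outdeg-reach (fib-positive (suc e))) ⟩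
  fib (3 + e) + fib (2 + e)                ∎
  where open ≡-Reasoning

outdeg-fib : ∀ e → outdeg (fib (2 + e)) ≡ fib (1 + e)
outdeg-fib zero    = refl
outdeg-fib (suc e) = trans (cong outdeg (sym (reach-fib e))) (outdeg-reach (fib-positive (suc e)))

outdeg-< : ∀ {j} → 1 < j → outdeg j < j
outdeg-< {suc i} (s≤s 1≤i) = s≤s (outdeg-minimal {suc i} z<s 1≤i (<-reach 1≤i))

outdeg-≤-window : ∀ e {j} → 1 ≤ j → j ≤ fib (3 + e) → outdeg j ≤ fib (2 + e)
outdeg-≤-window e {j} 1≤j hi = outdeg-minimal 1≤j (fib-positive (suc e)) (subst (j ≤_) (sym (reach-fib e)) hi)

fib-outdeg⇒outdeg-top : ∀ e {j} → fib (2 + e) < j → j ≤ fib (3 + e) → ∀ m → fib m ≡ outdeg j → outdeg j ≡ fib (2 + e)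
fib-outdeg⇒outdeg-top zero {j} lo hi _ _ = ≤-antisym (outdeg-≤-window zero 1≤j hi) (outdeg-positive 1≤j)
  where
    1≤j : 1 ≤ j
    1≤j = m<n⇒0<n lo
fib-outdeg⇒outdeg-top (suc e) {j} lo hi m fib-m≡ = trans (sym fib-m≡) (fib-in-window e m
  (subst (fib (2 + e) <_) (sym fib-m≡) (<-outdeg 1≤j (fib-positive (suc e)) (subst (_< j) (sym (reach-fib e)) lo)))
  (subst (_≤ fib (3 + e)) (sym fib-m≡) (outdeg-≤-window (suc e) 1≤j hi)))
  where
    1≤j : 1 ≤ j
    1≤j = m<n⇒0<n lo

module Paths (n : ℕ) where

  path-nonempty : ∀ {j q} → PathJ n j q → 1 ≤ length q
  path-nonempty (trivial _)    = s≤s z≤n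
  path-nonempty (extend _ _ _) = s≤s z≤n

  path-bound : ∀ {j q} → PathJ n j q → j ≤ fib (suc (length q))
  path-bound (trivial _) = ≤-refl
  path-bound (extend {i} {xs = xs} path (1≤i , _ , k≤reach-i) _) =
    ≤-trans k≤reach-i (subst (reach i ≤_) (reach-fib (length xs)) (reach-mono-≤ 1≤i (path-bound path)))

  length-lower : ∀ e {j q} → fib (suc e) < j → PathJ n j q → suc e ≤ length q
  length-lower e lo path = ≮⇒≥ λ short → <⇒≱ lo (≤-trans (path-bound path) (fib-mono short))

  -- Greedy path: step back from v_j to its least in-neighbour v_{d⁺(v_j)}.
  path-to : ∀ e {j} → 1 ≤ j → j ≤ n → j ≤ fib (2 + e) → ∃ λ xs → PathJ n j (j ∷ xs) × length xs ≤ e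
  path-to e {j} 1≤j j≤n j≤fib with m≤n⇒m<n∨m≡n 1≤j
  ... | inj₂ refl = [] , trivial j≤n , z≤n
  path-to zero    {j} 1≤j j≤n j≤fib | inj₁ 1<j = contradiction j≤fib (<⇒≱ 1<j)
  path-to (suc e) {j} 1≤j j≤n j≤fib | inj₁ 1<j
    with path-to e (outdeg-positive 1≤j) (≤-trans (<⇒≤ (outdeg-< 1<j)) j≤n) (outdeg-≤-window e 1≤j j≤fib)
  ... | xs , path , len = outdeg j ∷ xs , extend path (outdeg-positive 1≤j , outdeg-< 1<j , reach-outdeg 1≤j) j≤n , s≤s len

  penultimate-fib : ∀ e {i j xs} → PathJ n i (i ∷ xs) → Arc i j → outdeg j ≡ fib (2 + e) →
                    length xs ≡ e → i ≡ fib (2 + e)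
  penultimate-fib e {i} path (1≤i , i<j , j≤reach-i) outdeg≡ refl = ≤-antisym (path-bound path)
    (subst (_≤ i) outdeg≡ (outdeg-minimal (≤-trans 1≤i (<⇒≤ i<j)) 1≤i j≤reach-i))

  geodesics-unique : ∀ e {j q q′} → outdeg j ≡ fib (suc e) → PathJ n j q → PathJ n j q′ →
                     length q ≡ suc e → length q′ ≡ suc e → q ≡ q′
  geodesics-unique zero    _ (trivial _)    (trivial _)    _  _   = refl
  geodesics-unique zero    _ (extend _ _ _) _              () _
  geodesics-unique zero    _ (trivial _)    (extend _ _ _) _  ()
  geodesics-unique (suc e) _ (trivial _)    _              () _
  geodesics-unique (suc e) _ (extend _ _ _) (trivial _)    _  ()
  geodesics-unique (suc e) {j} outdeg≡ (extend p arc _) (extend p′ arc′ _) len len′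
    with penultimate-fib e p arc outdeg≡ (suc-injective (suc-injective len))
       | penultimate-fib e p′ arc′ outdeg≡ (suc-injective (suc-injective len′))
  ... | refl | refl = cong (j ∷_) (geodesics-unique e {fib (2 + e)} (outdeg-fib e) p p′ (suc-injective len) (suc-injective len′))

  unique-shortest : ∀ e {j} → 1 ≤ j → j ≤ n → j ≤ fib (2 + e) → outdeg j ≡ fib (suc e) →
                    (∀ {q} → PathJ n j q → suc e ≤ length q) → UniqueShortestPath n j
  unique-shortest e {j} 1≤j j≤n j≤fib outdeg≡ lower with path-to e 1≤j j≤n j≤fib
  ... | xs , path , len = j ∷ xs , path , (λ q q-path → subst (_≤ length q) (sym len≡) (lower q-path))
                        , λ q q-path len-q → geodesics-unique e {j} {q} outdeg≡ q-path path (trans len-q len≡) len≡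
    where
      len≡ : length (j ∷ xs) ≡ suc e
      len≡ = ≤-antisym (s≤s len) (lower path)

  unique⇒outdeg-top : ∀ e {j} → fib (2 + e) < j → j ≤ fib (3 + e) → j ≤ n →
                      UniqueShortestPath n j → outdeg j ≡ fib (2 + e)
  unique⇒outdeg-top e {j} lo hi j≤n (p , p-path , minimal , unique) =
    ≤-antisym (outdeg-≤-window e 1≤j hi) (≮⇒≥ not-below)
    where
      1≤j : 1 ≤ j
      1≤j = m<n⇒0<n lo

      shortest : ∀ {q} → PathJ n j q → length q ≤ 2 + e → q ≡ p
      shortest q-path short =
        unique _ q-path (≤-antisym (≤-trans short (length-lower (suc e) lo p-path)) (minimal _ q-path))

      via : ∀ {i} → 1 ≤ i → i ≤ fib (2 + e) → j ≤ reach i → ∃ λ xs → j ∷ i ∷ xs ≡ p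
      via {i} 1≤i i≤fib j≤reach-i with path-to e 1≤i (≤-trans (<⇒≤ (≤-<-trans i≤fib lo)) j≤n) i≤fib
      ... | xs , i-path , len =
        xs , shortest (extend i-path (1≤i , ≤-<-trans i≤fib lo , j≤reach-i) j≤n) (s≤s (s≤s len))

      not-below : ¬ outdeg j < fib (2 + e)
      not-below c<fib
        with via (outdeg-positive 1≤j) (<⇒≤ c<fib) (reach-outdeg 1≤j)
           | via {suc (outdeg j)} z<s c<fib (≤-trans (reach-outdeg 1≤j) (reach-mono-≤ (outdeg-positive 1≤j) (n≤1+n _)))
      ... | _ , via-c | _ , via-1+c = 1+n≢n (∷-injectiveˡ (∷-injectiveʳ (trans via-1+c (sym via-c))))

proposition4p2 : (n j : ℕ) → 1 ≤ j → j ≤ n →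
    (UniqueShortestPath n j ⇔ ∃ λ m → fib m ≡ outdeg j)
proposition4p2 n j 1≤j j≤n with m≤n⇒m<n∨m≡n 1≤j
... | inj₂ refl = mk⇔ (λ _ → 1 , refl) (λ _ → unique-shortest 0 ≤-refl j≤n ≤-refl refl path-nonempty)
  where open Paths n
... | inj₁ 1<j with fib-window j 1<j
...   | e , lo , hi = mk⇔
  (λ unique → 2 + e , sym (unique⇒outdeg-top e lo hi j≤n unique))
  (λ (m , fib-m≡) → unique-shortest (suc e) 1≤j j≤n hi (fib-outdeg⇒outdeg-top e lo hi m fib-m≡) (length-lower (suc e) lo))
  where open Paths n
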